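{- Let $W$ be an $m\times m$ widely-spaced primes matrix. If $\Pi(diag(SymSqr(W)))\prec\Pi(diag(W))$, then $\Pi(diag(W\times W))\prec\Pi(diag(W))$ and $\Pi(diag(W\times W))=\Pi(diag(SymSqr(W)))$, where $W\times W$ is the ordinary matrix product.
   Context: For an array $X$, $\Pi(diag(X))$ is the partition of $\{1,\dots,m\}$ with $i,r$ in the same cell iff $X_{i,i}=X_{r,r}$; $\prec$ denotes strict refinement (every cell of the first partition lies in a cell of the second, and the partitions differ). Widely-spaced primes matrix: a symmetric $m\times m$ matrix whose $n$ distinct entries are primes $p_1<\dots<p_n$ with $p_1>mk^2$ for some positive integer $k$ and $p_i>m\,p_{i-1}^2$ for $i\ge2$, where the off-diagonal entries take values among $p_1,\dots,p_{n_1}$ and the diagonal entries among $p_{n_1+1},\dots,p_n$. Canonical inner product string of $W$ at $(i,j)$: terms $(W_{i,k},W_{k,j})$, $k=1,\dots,m$; list first the terms involving a diagonal entry (if $i\ne j$: $(W_{i,i},W_{i,j})$ then $(W_{i,j},W_{j,j})$; if $i=j$: $(W_{i,i},W_{i,i})$), then the rest sorted lexicographically. $SymSqr(W)$ has $(i,j)$ and $(j,i)$ entries equal to the lexicographically lesser of the canonical strings at $(i,j)$ and $(j,i)$. -}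

module Defs where

open import Data.Nat using (ℕ; _+_; _*_; _^_; _<_; _≤_)
open import Data.Nat.Properties using (≤-decTotalOrder)
import Data.Nat as ℕ
open import Data.Nat.Primality using (Prime)
open import Data.Fin using (Fin)
import Data.Fin as Fin
open import Data.List using (List; []; _∷_; map; filter; allFin)
open import Data.Nat.ListAction using (sum)
import Data.Bool
import Data.List.Sort
open import Data.Bool using (Bool; true; false; if_then_else_)
open import Data.Product using (_×_; _,_; ∃; ∃-syntax; Σ-syntax)
open import Data.Product.Relation.Binary.Lex.NonStrict using (×-decTotalOrder)
open import Relation.Nullary using (¬_; yes; no; ¬?)
open import Relation.Nullary.Decidable using (_×-dec_; ⌊_⌋)
open import Relation.Binary.PropositionalEquality using (_≡_)
open import Function.Bundles using (_⇔_)

Matrix : ℕ → Set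
Matrix m = Fin m → Fin m → ℕ

-- The primes p₁ < … < pₙ of the paper are p 0 < … < p (n-1) here (0-indexed);
-- off-diagonal entries lie among p 0 … p (n₁-1), diagonal entries among
-- p n₁ … p (n-1).

record IsWidelySpacedPrimesMatrix {m : ℕ} (W : Matrix m) : Set where
  field
    n n₁ k     : ℕ
    p          : ℕ → ℕ
    k-pos      : 0 < k
    n₁≤n       : n₁ ≤ n
    symmetric  : ∀ a b → W a b ≡ W b a
    prime      : ∀ i → i < n → Prime (p i)
    increasing : ∀ i → ℕ.suc i < n → p i < p (ℕ.suc i)
    spaced₁    : 0 < n → m * k ^ 2 < p 0
    spaced     : ∀ i → ℕ.suc i < n → m * p i ^ 2 < p (ℕ.suc i)
    entries    : ∀ a b → ∃[ i ] (i < n × W a b ≡ p i)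
    attained   : ∀ i → i < n → ∃[ a ] ∃[ b ] (W a b ≡ p i)
    offdiag    : ∀ a b → ¬ (a ≡ b) → ∃[ i ] (i < n₁ × W a b ≡ p i)
    diag       : ∀ a → ∃[ i ] (n₁ ≤ i × i < n × W a a ≡ p i)

-- Partitions of the index set given by the diagonal, and strict refinement.
-- A partition of Fin m is represented by its equivalence relation
-- ("i and r lie in the same cell").

Partition : ℕ → Set₁
Partition m = Fin m → Fin m → Set

ΠDiag : {m : ℕ} {A : Set} → (Fin m → Fin m → A) → Partition m
ΠDiag X i r = X i i ≡ X r r

_Refines_ : {m : ℕ} → Partition m → Partition m → Set
P Refines Q = ∀ i r → P i r → Q i r

_≈P_ : {m : ℕ} → Partition m → Partition m → Set
P ≈P Q = ∀ i r → P i r ⇔ Q i r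

_≺_ : {m : ℕ} → Partition m → Partition m → Set
P ≺ Q = P Refines Q × ¬ (P ≈P Q)

_⊗_ : {m : ℕ} → Matrix m → Matrix m → Matrix m
(A ⊗ B) i j = sum (map (λ k → A i k * B k j) (allFin _))

Term : Set
Term = ℕ × ℕ

TermOrder = ×-decTotalOrder ≤-decTotalOrder ≤-decTotalOrder

sortTerms : List Term → List Term
sortTerms = Data.List.Sort.sort TermOrder

_<T_ : Term → Term → Bool
(a , b) <T (c , d) = ⌊ a ℕ.<? c ⌋ Data.Bool.∨ (⌊ a ℕ.≟ c ⌋ Data.Bool.∧ ⌊ b ℕ.<? d ⌋)

_=T_ : Term → Term → Bool
(a , b) =T (c , d) = ⌊ a ℕ.≟ c ⌋ Data.Bool.∧ ⌊ b ℕ.≟ d ⌋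

lexLeq : List Term → List Term → Bool
lexLeq [] _ = true
lexLeq (_ ∷ _) [] = false
lexLeq (x ∷ xs) (y ∷ ys) =
  if x <T y then true else (if x =T y then lexLeq xs ys else false)

lexMin : List Term → List Term → List Term
lexMin s t = if lexLeq s t then s else t

canon : {m : ℕ} → Matrix m → Fin m → Fin m → List Term
canon {m} W i j with i Fin.≟ j
... | yes _ = (W i i , W i i)
              ∷ sortTerms (map (λ k → (W i k , W k j))
                               (filter (λ k → ¬? (k Fin.≟ i)) (allFin m)))
... | no _  = (W i i , W i j) ∷ (W i j , W j j)
              ∷ sortTerms (map (λ k → (W i k , W k j))
                               (filter (λ k → ¬? (k Fin.≟ i) ×-dec ¬? (k Fin.≟ j)) (allFin m)))

SymSqr : {m : ℕ} → Matrix m → Fin m → Fin m → List Term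
SymSqr W i j = lexMin (canon W i j) (canon W j i)

-- The i-th diagonal entry of W × W is W_ii² + Σ_{k≠i} W_ik², and the i-th diagonal
-- string of SymSqr(W) records W_ii together with the multiset of off-diagonal entries
-- of row i. Both are functions of the pair (W_ii, that multiset); wide spacing makes
-- the converse true for W × W as well: W_ii² dominates the sum of squares of smaller
-- primes, and a sum of at most m squares of primes p_j with p_{j+1} > m p_j² determines
-- its multiset of summands, like a base expansion. Hence the two diagonal partitions
-- coincide, and the strict refinement transfers from one to the other.
module Submission where

open import Data.Bool using (true; false)
open import Data.Empty using (⊥-elim)
open import Data.Fin using (Fin)
import Data.Fin as Fin
open import Data.List using (List; []; _∷_; map; filter; allFin; length)
open import Data.List.Membership.Propositional using (_∈_)
open import Data.List.Membership.Propositional.Properties using (∈-allFin)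
open import Data.List.Properties
  using (filter-all; filter-accept; filter-reject; length-tabulate; length-map; map-cong; map-∘; map-id; ∷-injective)
open import Data.List.Relation.Binary.Permutation.Propositional
  using (_↭_; ↭-refl; ↭-sym; ↭-trans; prep; swap; ↭⇒↭ₛ′)
open import Data.List.Relation.Binary.Permutation.Propositional.Properties
  using (All-resp-↭; ↭-length; map⁺)
open import Data.List.Relation.Binary.Pointwise as Pointwise using (Pointwise-≡⇒≡)
open import Data.List.Relation.Unary.All as All using (All; []; _∷_)
open import Data.List.Relation.Unary.All.Properties using (all-filter) renaming (map⁺ to All-map⁺)
open import Data.List.Relation.Unary.AllPairs using (_∷_)
open import Data.List.Relation.Unary.Any using (here; there)
open import Data.List.Relation.Unary.Linked as Linked using (Linked)
open import Data.List.Relation.Unary.Linked.Properties using (Linked⇒All)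
open import Data.List.Relation.Unary.Unique.Propositional using (Unique)
open import Data.List.Relation.Unary.Unique.Propositional.Properties using (allFin⁺)
import Data.List.Relation.Unary.Sorted.TotalOrder.Properties as Sorted
import Data.List.Sort as Sort
open import Data.Nat
open import Data.Nat.ListAction using (sum)
open import Data.Nat.ListAction.Properties using (sum-↭)
open import Data.Nat.Properties
open import Data.Product using (_×_; _,_; proj₁; ∃-syntax)
open import Data.Product.Relation.Binary.Pointwise.NonDependent using (≡×≡⇒≡)
open import Data.Sum using (inj₁; inj₂)
open import Function using (_∘_)
open import Function.Bundles using (_⇔_; mk⇔; Equivalence)
open import Relation.Binary.Bundles using (DecTotalOrder)
import Relation.Binary.Construct.Flip.EqAndOrd as Flip
open import Relation.Binary.Definitions using (DecidableEquality; tri<; tri≈; tri>)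
open import Relation.Binary.PropositionalEquality using (_≡_; refl; sym; trans; cong; cong₂; subst; subst₂; module ≡-Reasoning)
open import Relation.Nullary using (¬?; yes; no)

open import Defs

module _ {A : Set} (_≟_ : DecidableEquality A) where

  without : A → List A → List A
  without x = filter (λ y → ¬? (y ≟ x))

  ↭-∷-without : ∀ {x xs} → Unique xs → x ∈ xs → xs ↭ x ∷ without x xs
  ↭-∷-without {x} {x ∷ ys} (x∉ys ∷ _) (here refl) =
    prep x (subst (ys ↭_) (sym without-x) ↭-refl)
    where
      without-x : without x (x ∷ ys) ≡ ys
      without-x = trans (filter-reject (λ y → ¬? (y ≟ x)) (λ x≢x → x≢x refl))
                        (filter-all (λ y → ¬? (y ≟ x)) (All.map (λ y≢x x≡y → y≢x (sym x≡y)) x∉ys))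
  ↭-∷-without {x} {y ∷ ys} (y∉ys ∷ uys) (there x∈ys) =
    subst (λ zs → y ∷ ys ↭ x ∷ zs)
      (sym (filter-accept (λ z → ¬? (z ≟ x)) (All.lookup y∉ys x∈ys)))
      (↭-trans (prep y (↭-∷-without uys x∈ys)) (swap y x ↭-refl))

module _ {a ℓ₁ ℓ₂} (O : DecTotalOrder a ℓ₁ ℓ₂) (≈⇒≡ : ∀ {x y} → DecTotalOrder._≈_ O x y → x ≡ y) where
  open Sort O
  open DecTotalOrder O using (totalOrder; isEquivalence)

  sort-≡⇔↭ : ∀ {xs ys} → sort xs ≡ sort ys ⇔ (xs ↭ ys)
  sort-≡⇔↭ {xs} {ys} = mk⇔ sort-≡⇒↭ ↭⇒sort-≡
    where
      sort-≡⇒↭ : sort xs ≡ sort ys → xs ↭ ys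
      sort-≡⇒↭ eq = ↭-trans (↭-sym (sort-↭ xs)) (subst (_↭ ys) (sym eq) (sort-↭ ys))

      ↭⇒sort-≡ : xs ↭ ys → sort xs ≡ sort ys
      ↭⇒sort-≡ xs↭ys = Pointwise-≡⇒≡ (Pointwise.map ≈⇒≡
        (Sorted.↗↭↗⇒≋ totalOrder (sort-↗ xs) (sort-↗ ys)
          (↭⇒↭ₛ′ isEquivalence (↭-trans (sort-↭ xs) (↭-trans xs↭ys (↭-sym (sort-↭ ys)))))))

sumOfSquares : List ℕ → ℕ
sumOfSquares xs = sum (map (λ x → x * x) xs)

sumOfSquares-↭ : ∀ {xs ys} → xs ↭ ys → sumOfSquares xs ≡ sumOfSquares ys
sumOfSquares-↭ = sum-↭ ∘ map⁺ (λ x → x * x)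

sumOfSquares-≤ : ∀ {b} xs → All (_≤ b) xs → sumOfSquares xs ≤ length xs * (b * b)
sumOfSquares-≤ [] [] = z≤n
sumOfSquares-≤ (x ∷ xs) (x≤b ∷ xs≤b) = +-mono-≤ (*-mono-≤ x≤b x≤b) (sumOfSquares-≤ xs xs≤b)

Descending : List ℕ → Set
Descending = Linked (λ x y → y ≤ x)

descendingOrder : DecTotalOrder _ _ _
descendingOrder = Flip.decTotalOrder ≤-decTotalOrder

sortDescending : List ℕ → List ℕ
sortDescending = Sort.sort descendingOrder

sumOfSquares-≤-head : ∀ {y ys} → Descending (y ∷ ys) → sumOfSquares (y ∷ ys) ≤ length (y ∷ ys) * (y * y)
sumOfSquares-≤-head {y} {ys} desc =
  sumOfSquares-≤ (y ∷ ys) (Linked⇒All (λ y≤x z≤y → ≤-trans z≤y y≤x) ≤-refl desc)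

WidelySpaced : ℕ → (ℕ → Set) → Set
WidelySpaced m S = ∀ {x y} → S x → S y → y < x → m * (y * y) < x

module _ {m : ℕ} {S : ℕ → Set} (spaced : WidelySpaced m S) where

  sumOfSquares-<-head : ∀ {x y} xs ys → Descending (y ∷ ys) → S x → S y →
                        length (y ∷ ys) ≤ m → y < x → sumOfSquares (y ∷ ys) < sumOfSquares (x ∷ xs)
  sumOfSquares-<-head {x} {y} xs ys desc Sx Sy length≤m y<x = begin-strict
    sumOfSquares (y ∷ ys)     ≤⟨ sumOfSquares-≤-head desc ⟩
    length (y ∷ ys) * (y * y) ≤⟨ *-monoˡ-≤ (y * y) length≤m ⟩
    m * (y * y)               <⟨ spaced Sx Sy y<x ⟩
    x                         ≤⟨ m≤m*n x x {{>-nonZero (<-≤-trans z<s y<x)}} ⟩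
    x * x                     ≤⟨ m≤m+n (x * x) _ ⟩
    sumOfSquares (x ∷ xs)     ∎
    where open ≤-Reasoning

  sumOfSquares-injective-descending : ∀ xs ys → Descending xs → Descending ys → All S xs → All S ys →
    length xs ≡ length ys → length xs ≤ m → sumOfSquares xs ≡ sumOfSquares ys → xs ≡ ys
  sumOfSquares-injective-descending [] [] _ _ _ _ _ _ _ = refl
  sumOfSquares-injective-descending (x ∷ xs) (y ∷ ys) dx dy (Sx ∷ Sxs) (Sy ∷ Sys) |xs|≡|ys| |xs|≤m eq
    with <-cmp x y
  ... | tri< x<y _ _ = ⊥-elim (<-irrefl eq (sumOfSquares-<-head ys xs dx Sy Sx |xs|≤m x<y))
  ... | tri> _ _ y<x = ⊥-elim (<-irrefl (sym eq)
          (sumOfSquares-<-head xs ys dy Sx Sy (subst (_≤ m) |xs|≡|ys| |xs|≤m) y<x))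
  ... | tri≈ _ refl _ = cong (x ∷_) (sumOfSquares-injective-descending xs ys
          (Linked.tail dx) (Linked.tail dy) Sxs Sys (suc-injective |xs|≡|ys|)
          (≤-trans (n≤1+n _) |xs|≤m) (+-cancelˡ-≡ (x * x) _ _ eq))

  sumOfSquares-injective : ∀ {xs ys} → All S xs → All S ys → length xs ≡ length ys → length xs ≤ m →
                           sumOfSquares xs ≡ sumOfSquares ys → xs ↭ ys
  sumOfSquares-injective {xs} {ys} Sxs Sys |xs|≡|ys| |xs|≤m eq =
    Equivalence.to (sort-≡⇔↭ descendingOrder (λ x≡y → x≡y))
      (sumOfSquares-injective-descending (sortDescending xs) (sortDescending ys)
        (Sort.sort-↗ descendingOrder xs) (Sort.sort-↗ descendingOrder ys)
        (All-resp-↭ (↭-sym (sorted-↭ xs)) Sxs) (All-resp-↭ (↭-sym (sorted-↭ ys)) Sys)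
        (trans (↭-length (sorted-↭ xs)) (trans |xs|≡|ys| (sym (↭-length (sorted-↭ ys)))))
        (subst (_≤ m) (sym (↭-length (sorted-↭ xs))) |xs|≤m)
        (trans (sumOfSquares-↭ (sorted-↭ xs)) (trans eq (sym (sumOfSquares-↭ (sorted-↭ ys))))))
    where
      sorted-↭ : ∀ zs → sortDescending zs ↭ zs
      sorted-↭ = Sort.sort-↭ descendingOrder

lexMin-idem : ∀ s → lexMin s s ≡ s
lexMin-idem s with lexLeq s s
... | true = refl
... | false = refl

≈P-sym : ∀ {m} {P Q : Partition m} → P ≈P Q → Q ≈P P
≈P-sym P≈Q i r = mk⇔ (Equivalence.from (P≈Q i r)) (Equivalence.to (P≈Q i r))

≈P-trans : ∀ {m} {P Q R : Partition m} → P ≈P Q → Q ≈P R → P ≈P R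
≈P-trans P≈Q Q≈R i r = mk⇔ (Equivalence.to (Q≈R i r) ∘ Equivalence.to (P≈Q i r))
                           (Equivalence.from (P≈Q i r) ∘ Equivalence.from (Q≈R i r))

≈P-respˡ-≺ : ∀ {m} {P Q R : Partition m} → P ≈P Q → Q ≺ R → P ≺ R
≈P-respˡ-≺ P≈Q (Q⊑R , Q≉R) =
  (λ i r → Q⊑R i r ∘ Equivalence.to (P≈Q i r)) , (λ P≈R → Q≉R (≈P-trans (≈P-sym P≈Q) P≈R))

module SymmetricMatrix {m : ℕ} (W : Matrix m) (symmetric : ∀ a b → W a b ≡ W b a) where

  offDiagonal : Fin m → List (Fin m)
  offDiagonal i = without Fin._≟_ i (allFin m)

  row : Fin m → List ℕ
  row i = map (W i) (offDiagonal i)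

  SameDiagonalAndRow : Fin m → Fin m → Set
  SameDiagonalAndRow i r = W i i ≡ W r r × row i ↭ row r

  allFin-↭ : ∀ i → allFin m ↭ i ∷ offDiagonal i
  allFin-↭ i = ↭-∷-without Fin._≟_ (allFin⁺ m) (∈-allFin i)

  suc-length-row : ∀ i → suc (length (row i)) ≡ m
  suc-length-row i = begin
    suc (length (row i))         ≡⟨ cong suc (length-map (W i) (offDiagonal i)) ⟩
    length (i ∷ offDiagonal i)   ≡⟨ ↭-length (↭-sym (allFin-↭ i)) ⟩
    length (allFin m)            ≡⟨ length-tabulate {n = m} (λ k → k) ⟩
    m                            ∎
    where open ≡-Reasoning

  ⊗-diagonal : ∀ i → (W ⊗ W) i i ≡ W i i * W i i + sumOfSquares (row i)
  ⊗-diagonal i = begin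
    (W ⊗ W) i i                                                    ≡⟨ sum-↭ (map⁺ (λ k → W i k * W k i) (allFin-↭ i)) ⟩
    W i i * W i i + sum (map (λ k → W i k * W k i) (offDiagonal i)) ≡⟨ cong (λ s → W i i * W i i + sum s) rowSquares ⟩
    W i i * W i i + sumOfSquares (row i)                            ∎
    where
      open ≡-Reasoning
      rowSquares : map (λ k → W i k * W k i) (offDiagonal i) ≡ map (λ x → x * x) (row i)
      rowSquares = trans (map-cong (λ k → cong (W i k *_) (symmetric k i)) (offDiagonal i)) (map-∘ (offDiagonal i))

  pairWithItself : ℕ → Term
  pairWithItself x = (x , x)

  SymSqr-diagonal : ∀ i → SymSqr W i i ≡ (W i i , W i i) ∷ sortTerms (map pairWithItself (row i))
  SymSqr-diagonal i with i Fin.≟ i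
  ... | no i≢i = ⊥-elim (i≢i refl)
  ... | yes _ = trans (lexMin-idem _) (cong (λ s → (W i i , W i i) ∷ sortTerms s)
          (trans (map-cong (λ k → cong (W i k ,_) (symmetric k i)) (offDiagonal i)) (map-∘ (offDiagonal i))))

  map-pairWithItself-↭ : ∀ {xs ys} → map pairWithItself xs ↭ map pairWithItself ys → xs ↭ ys
  map-pairWithItself-↭ {xs} {ys} p =
    subst₂ _↭_ (unpair xs) (unpair ys) (map⁺ proj₁ p)
    where
      unpair : ∀ zs → map proj₁ (map pairWithItself zs) ≡ zs
      unpair zs = trans (sym (map-∘ zs)) (map-id zs)

  SymSqr-diagonal-≡⇔ : ∀ i r → (SymSqr W i i ≡ SymSqr W r r) ⇔ SameDiagonalAndRow i r
  SymSqr-diagonal-≡⇔ i r = mk⇔ to from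
    where
      sortTerms-≡⇔↭ = sort-≡⇔↭ TermOrder ≡×≡⇒≡

      to : SymSqr W i i ≡ SymSqr W r r → SameDiagonalAndRow i r
      to eq with ∷-injective (trans (sym (SymSqr-diagonal i)) (trans eq (SymSqr-diagonal r)))
      ... | heads , tails = cong proj₁ heads , map-pairWithItself-↭ (Equivalence.to sortTerms-≡⇔↭ tails)

      from : SameDiagonalAndRow i r → SymSqr W i i ≡ SymSqr W r r
      from (diagonal , rows) = trans (SymSqr-diagonal i) (trans
        (cong₂ (λ d s → (d , d) ∷ s) diagonal (Equivalence.from sortTerms-≡⇔↭ (map⁺ pairWithItself rows)))
        (sym (SymSqr-diagonal r)))

  ⊗-diagonal-≡-from : ∀ i r → SameDiagonalAndRow i r → (W ⊗ W) i i ≡ (W ⊗ W) r r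
  ⊗-diagonal-≡-from i r (diagonal , rows) =
    trans (⊗-diagonal i) (trans (cong₂ (λ d s → d * d + s) diagonal (sumOfSquares-↭ rows)) (sym (⊗-diagonal r)))

module WidelySpacedPrimesMatrix {m : ℕ} {W : Matrix m} (ws : IsWidelySpacedPrimesMatrix W) where
  open IsWidelySpacedPrimesMatrix ws
  open SymmetricMatrix W symmetric

  p-mono-≤ : ∀ {a b} → a ≤ b → b < n → p a ≤ p b
  p-mono-≤ {b = zero} z≤n _ = ≤-refl
  p-mono-≤ {a} {suc b} a≤1+b 1+b<n with m≤n⇒m<n∨m≡n a≤1+b
  ... | inj₂ refl = ≤-refl
  ... | inj₁ a<1+b = ≤-trans (p-mono-≤ (s≤s⁻¹ a<1+b) (<-trans (n<1+n b) 1+b<n)) (<⇒≤ (increasing b 1+b<n))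

  m*p²<p : ∀ {a b} → a < b → b < n → m * (p a * p a) < p b
  m*p²<p {a} {suc b} a<1+b 1+b<n = begin-strict
    m * (p a * p a) ≤⟨ *-monoʳ-≤ m (*-mono-≤ pa≤pb pa≤pb) ⟩
    m * (p b * p b) ≡⟨ cong (λ x → m * (p b * x)) (sym (*-identityʳ (p b))) ⟩
    m * p b ^ 2     <⟨ spaced b 1+b<n ⟩
    p (suc b)       ∎
    where
      open ≤-Reasoning
      pa≤pb = p-mono-≤ (s≤s⁻¹ a<1+b) (<-trans (n<1+n b) 1+b<n)

  OffDiagonalValue : ℕ → Set
  OffDiagonalValue x = ∃[ j ] (j < n₁ × x ≡ p j)

  offDiagonalValues-widelySpaced : WidelySpaced m OffDiagonalValue
  offDiagonalValues-widelySpaced (a , a<n₁ , refl) (b , b<n₁ , refl) pb<pa with <-cmp b a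
  ... | tri< b<a _ _ = m*p²<p b<a (≤-trans a<n₁ n₁≤n)
  ... | tri≈ _ refl _ = ⊥-elim (<-irrefl refl pb<pa)
  ... | tri> _ _ a<b = ⊥-elim (<⇒≱ pb<pa (p-mono-≤ (<⇒≤ a<b) (≤-trans b<n₁ n₁≤n)))

  row-offDiagonalValues : ∀ i → All OffDiagonalValue (row i)
  row-offDiagonalValues i = All-map⁺ (All.map (λ k≢i → offdiag i _ (k≢i ∘ sym))
                                               (all-filter (λ k → ¬? (k Fin.≟ i)) (allFin m)))

  entry≤diagonal : ∀ i k → W i k ≤ W i i
  entry≤diagonal i k with diag i | k Fin.≟ i
  ... | _ | yes refl = ≤-refl
  ... | (a , n₁≤a , a<n , Wii≡pa) | no k≢i with offdiag i k (k≢i ∘ sym)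
  ... | (j , j<n₁ , Wik≡pj) =
    subst₂ _≤_ (sym Wik≡pj) (sym Wii≡pa) (p-mono-≤ (≤-trans (<⇒≤ j<n₁) n₁≤a) a<n)

  ⊗-diagonal-≤ : ∀ i → (W ⊗ W) i i ≤ m * (W i i * W i i)
  ⊗-diagonal-≤ i = begin
    (W ⊗ W) i i                           ≤⟨ sum-≤ (allFin m) ⟩
    length (allFin m) * (W i i * W i i)   ≡⟨ cong (_* (W i i * W i i)) (length-tabulate {n = m} (λ k → k)) ⟩
    m * (W i i * W i i)                   ∎
    where
      open ≤-Reasoning
      sum-≤ : ∀ ks → sum (map (λ k → W i k * W k i) ks) ≤ length ks * (W i i * W i i)
      sum-≤ [] = z≤n
      sum-≤ (k ∷ ks) = +-mono-≤
        (*-mono-≤ (entry≤diagonal i k) (subst (_≤ W i i) (symmetric i k) (entry≤diagonal i k))) (sum-≤ ks)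

  ⊗-diagonal-< : ∀ {i r a b} → W i i ≡ p a → W r r ≡ p b → a < b → b < n → (W ⊗ W) i i < (W ⊗ W) r r
  ⊗-diagonal-< {i} {r} {a} {b} Wii≡pa Wrr≡pb a<b b<n = begin-strict
    (W ⊗ W) i i                          ≤⟨ ⊗-diagonal-≤ i ⟩
    m * (W i i * W i i)                  ≡⟨ cong (λ d → m * (d * d)) Wii≡pa ⟩
    m * (p a * p a)                      <⟨ m*p²<p a<b b<n ⟩
    p b                                  ≤⟨ m≤m*n (p b) (p b) {{>-nonZero (<-≤-trans z<s (m*p²<p a<b b<n))}} ⟩
    p b * p b                            ≡⟨ cong (λ d → d * d) (sym Wrr≡pb) ⟩
    W r r * W r r                        ≤⟨ m≤m+n _ _ ⟩
    W r r * W r r + sumOfSquares (row r) ≡⟨ sym (⊗-diagonal r) ⟩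
    (W ⊗ W) r r                          ∎
    where open ≤-Reasoning

  ⊗-diagonal-≡⇒diagonal-≡ : ∀ i r → (W ⊗ W) i i ≡ (W ⊗ W) r r → W i i ≡ W r r
  ⊗-diagonal-≡⇒diagonal-≡ i r eq with diag i | diag r
  ... | (a , _ , a<n , Wii≡pa) | (b , _ , b<n , Wrr≡pb) with <-cmp a b
  ... | tri< a<b _ _ = ⊥-elim (<-irrefl eq (⊗-diagonal-< Wii≡pa Wrr≡pb a<b b<n))
  ... | tri≈ _ refl _ = trans Wii≡pa (sym Wrr≡pb)
  ... | tri> _ _ b<a = ⊥-elim (<-irrefl (sym eq) (⊗-diagonal-< Wrr≡pb Wii≡pa b<a a<n))

  ⊗-diagonal-≡-to : ∀ i r → (W ⊗ W) i i ≡ (W ⊗ W) r r → SameDiagonalAndRow i r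
  ⊗-diagonal-≡-to i r eq = diagonal , sumOfSquares-injective offDiagonalValues-widelySpaced
    (row-offDiagonalValues i) (row-offDiagonalValues r)
    (suc-injective (trans (suc-length-row i) (sym (suc-length-row r))))
    (subst (length (row i) ≤_) (suc-length-row i) (n≤1+n _))
    (+-cancelˡ-≡ (W i i * W i i) _ _ (begin
      W i i * W i i + sumOfSquares (row i) ≡⟨ sym (⊗-diagonal i) ⟩
      (W ⊗ W) i i                          ≡⟨ eq ⟩
      (W ⊗ W) r r                          ≡⟨ ⊗-diagonal r ⟩
      W r r * W r r + sumOfSquares (row r) ≡⟨ cong (λ d → d * d + sumOfSquares (row r)) (sym diagonal) ⟩
      W i i * W i i + sumOfSquares (row r) ∎))
    where
      open ≡-Reasoning
      diagonal = ⊗-diagonal-≡⇒diagonal-≡ i r eq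

  ΠDiag-⊗≈ΠDiag-SymSqr : ΠDiag (W ⊗ W) ≈P ΠDiag (SymSqr W)
  ΠDiag-⊗≈ΠDiag-SymSqr i r = mk⇔
    (Equivalence.from (SymSqr-diagonal-≡⇔ i r) ∘ ⊗-diagonal-≡-to i r)
    (⊗-diagonal-≡-from i r ∘ Equivalence.to (SymSqr-diagonal-≡⇔ i r))

theorem30 : (m : ℕ) (W : Matrix m) → IsWidelySpacedPrimesMatrix W →
            ΠDiag (SymSqr W) ≺ ΠDiag W →
            (ΠDiag (W ⊗ W) ≺ ΠDiag W) × (ΠDiag (W ⊗ W) ≈P ΠDiag (SymSqr W))
theorem30 m W ws SymSqr≺W = ≈P-respˡ-≺ ⊗≈SymSqr SymSqr≺W , ⊗≈SymSqr
  where ⊗≈SymSqr = WidelySpacedPrimesMatrix.ΠDiag-⊗≈ΠDiag-SymSqr ws
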